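{- Fix an integer $d\ge 6$. Let $Q$ be a graph on vertex set $V=K\cup\{u_1,u_2,u_3\}$, where $u_1,u_2,u_3$ are distinct vertices not in $K$, $Q[K]$ is a clique on $d$ vertices, $\{u_1,u_2,u_3\}$ is an independent set, and each $u_i$ is adjacent to all vertices of $K$. Then $Q$ is $(\deg-1)$-choosable.
   Context: A graph $Q=(V,E)$ is $(\deg-1)$-choosable if for every assignment of lists $L: V\to 2^{\mathbb{N}}$ with $|L(v)|=\deg(v,Q)-1$ for all $v\in V$, there exists a proper coloring $\varphi$ of $Q$ (adjacent vertices receive distinct colors) with $\varphi(v)\in L(v)$ for all $v\in V$. -}

module Defs where

open import Data.Nat using (ℕ; zero; suc; _+_; _∸_)
open import Data.Bool using (Bool; true; false; if_then_else_)
open import Data.Fin using (Fin)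
open import Data.List using (List; length; map; allFin)
open import Data.Nat.ListAction using (sum)
open import Data.List.Membership.Propositional using (_∈_)
open import Data.List.Relation.Unary.Unique.Propositional using (Unique)
open import Data.Product using (Σ; _×_)
open import Relation.Binary.PropositionalEquality using (_≡_; _≢_)

record Graph (n : ℕ) : Set where
  field
    adj   : Fin n → Fin n → Bool
    sym   : ∀ u v → adj u v ≡ adj v u
    irrefl : ∀ v → adj v v ≡ false

open Graph public

Adj : ∀ {n} → Graph n → Fin n → Fin n → Set
Adj Q u v = adj Q u v ≡ true

deg : ∀ {n} → Graph n → Fin n → ℕ
deg {n} Q v = sum (map (λ w → if adj Q v w then 1 else 0) (allFin n))

ProperListColouring : ∀ {n} → Graph n → (Fin n → List ℕ) → (Fin n → ℕ) → Set
ProperListColouring Q L φ =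
  (∀ v → φ v ∈ L v) × (∀ u v → Adj Q u v → φ u ≢ φ v)

DegMinusOneChoosable : ∀ {n} → Graph n → Set
DegMinusOneChoosable {n} Q =
  (L : Fin n → List ℕ) →
  (∀ v → Unique (L v)) →
  (∀ v → length (L v) ≡ deg Q v ∸ 1) →
  Σ (Fin n → ℕ) (λ φ → ProperListColouring Q L φ)

-- Every clique vertex has at least d + 1 colours and every uᵢ at least d − 1. Choose distinct
-- colours on the clique greedily. If every uᵢ still sees a colour of its list unused on the clique
-- we are done. Otherwise some list L(uᵢ) lies inside the set C of clique colours. Giving one clique
-- vertex a fresh colour outside C frees its old colour t, and t serves every uⱼ unless it is
-- blocked: for L(uᵢ) only the colour of C ∖ L(uᵢ) is, and for each other uⱼ at most the two colours
-- of C ∖ L(uⱼ) are, and only when L(uⱼ) has fewer than two colours outside C. So at most 5 of the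
-- d ≥ 6 colours of C are blocked.
module Submission where

open import Defs hiding (sym)
open import Data.Nat using (ℕ; zero; suc; _+_; _*_; _∸_; _≤_; _<_; z≤n; s≤s)
open import Data.Nat.Properties
open import Data.Bool using (true; false; if_then_else_; T; T?)
open import Data.Fin as Fin using (Fin; punchIn; punchOut)
open import Data.Fin.Patterns using (0F; 1F; 2F)
open import Data.Fin.Properties using (any?; punchIn-injective; punchInᵢ≢i; punchIn-punchOut)
open import Data.List using (List; []; _∷_; length; filter; filterᵇ; tabulate; _++_; map; allFin; concatMap)
open import Data.List.Properties using (length-tabulate; length-++)
open import Data.Nat.ListAction using (sum)
open import Data.List.Membership.Propositional using (_∈_; _∉_; find; lose)
open import Data.List.Membership.Propositional.Properties
open import Data.List.Membership.DecPropositional _≟_ using (_∈?_)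
open import Data.List.Relation.Binary.Subset.Propositional using (_⊆_)
open import Data.List.Relation.Unary.Any using (here; there)
import Data.List.Relation.Unary.All as All
open import Data.List.Relation.Unary.All.Properties using (¬All⇒Any¬)
import Data.List.Relation.Unary.AllPairs as AllPairs
open import Data.List.Relation.Unary.Unique.Propositional using (Unique)
import Data.List.Relation.Unary.Unique.Propositional.Properties as Unique
import Data.Vec.Functional as Vector
open Vector using (updateAt)
open import Data.Vec.Functional.Properties using (updateAt-updates; updateAt-minimal)
open import Data.Product using (Σ; ∃; _×_; _,_; proj₁; proj₂)
open import Data.Sum using (_⊎_; inj₁; inj₂; [_,_])
open import Data.Empty using (⊥-elim)
open import Function using (_∘_; id; const)
open import Function.Definitions using (Injective)
open import Relation.Nullary using (¬_; yes; no; ¬?; contradiction)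
open import Relation.Binary.PropositionalEquality using (_≡_; _≢_; refl; sym; trans; cong; subst)

⊆⇒length≤ : ∀ {A : Set} {X Y : List A} → Unique X → X ⊆ Y → length X ≤ length Y
⊆⇒length≤ {X = []} _ _ = z≤n
⊆⇒length≤ {X = x ∷ X} (x∉X AllPairs.∷ uX) X⊆Y with ys , zs , refl ← ∈-∃++ (X⊆Y (here refl)) =
  begin
    suc (length X)              ≤⟨ s≤s (⊆⇒length≤ uX X⊆ys++zs) ⟩
    suc (length (ys ++ zs))     ≡⟨ cong suc (length-++ ys) ⟩
    suc (length ys + length zs) ≡⟨ +-suc (length ys) (length zs) ⟨
    length ys + suc (length zs) ≡⟨ length-++ ys ⟨
    length (ys ++ x ∷ zs)       ∎
  where
  open ≤-Reasoning
  X⊆ys++zs : X ⊆ ys ++ zs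
  X⊆ys++zs {z} z∈X with ∈-++⁻ ys (X⊆Y (there z∈X))
  ... | inj₁ z∈ys         = ∈-++⁺ˡ z∈ys
  ... | inj₂ (here refl)  = contradiction refl (All.lookup x∉X z∈X)
  ... | inj₂ (there z∈zs) = ∈-++⁺ʳ ys z∈zs

∃∉-of-length< : ∀ {X Y : List ℕ} → Unique X → length Y < length X → ∃ λ x → x ∈ X × x ∉ Y
∃∉-of-length< {X} {Y} uX Y<X with All.all? (_∈? Y) X
... | yes X⊆Y = contradiction (⊆⇒length≤ uX (All.lookup X⊆Y)) (<⇒≱ Y<X)
... | no X⊈Y  = find (¬All⇒Any¬ (_∈? Y) X X⊈Y)

infixl 6 _∖_

_∖_ : List ℕ → List ℕ → List ℕ
C ∖ A = filter (λ t → ¬? (t ∈? A)) C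

∈-∖⁺ : ∀ {t C A} → t ∈ C → t ∉ A → t ∈ C ∖ A
∈-∖⁺ = ∈-filter⁺ (λ t → ¬? (t ∈? _))

∈-∖⁻ : ∀ {t} C {A} → t ∈ C ∖ A → t ∈ C × t ∉ A
∈-∖⁻ C = ∈-filter⁻ (λ t → ¬? (t ∈? _)) {xs = C}

∉-∖⇒∈ : ∀ {t C A} → t ∈ C → t ∉ C ∖ A → t ∈ A
∉-∖⇒∈ {t} {A = A} t∈C t∉C∖A with t ∈? A
... | yes t∈A = t∈A
... | no  t∉A = contradiction (∈-∖⁺ t∈C t∉A) t∉C∖A

∖-unique : ∀ {C} A → Unique C → Unique (C ∖ A)
∖-unique A = Unique.filter⁺ (λ t → ¬? (t ∈? A))

-- |A| + |C ∖ A| = |A ∪ C| = |C| + |A ∖ C|, weakened by enlarging A ∖ C to any list O.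
length-∖-bound : ∀ {A C O} → Unique A → Unique C → (∀ {a} → a ∈ A → a ∉ C → a ∈ O) →
                 length A + length (C ∖ A) ≤ length C + length O
length-∖-bound {A} {C} {O} uA uC A∖C⊆O = begin
  length A + length (C ∖ A) ≡⟨ length-++ A ⟨
  length (A ++ C ∖ A)       ≤⟨ ⊆⇒length≤ uA++C∖A A++C∖A⊆C++O ⟩
  length (C ++ O)           ≡⟨ length-++ C ⟩
  length C + length O       ∎
  where
  open ≤-Reasoning
  uA++C∖A : Unique (A ++ C ∖ A)
  uA++C∖A = Unique.++⁺ uA (∖-unique A uC) λ (t∈A , t∈C∖A) → proj₂ (∈-∖⁻ C t∈C∖A) t∈A
  A++C∖A⊆C++O : A ++ C ∖ A ⊆ C ++ O
  A++C∖A⊆C++O {t} t∈ with ∈-++⁻ A t∈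
  ... | inj₂ t∈C∖A = ∈-++⁺ˡ (proj₁ (∈-∖⁻ C t∈C∖A))
  ... | inj₁ t∈A with t ∈? C
  ...   | yes t∈C = ∈-++⁺ˡ t∈C
  ...   | no  t∉C = ∈-++⁺ʳ C (A∖C⊆O t∈A t∉C)

-- Why A keeps a colour outside C when one colour t of C is exchanged for a fresh one: either
-- A has two colours outside C, or t ∈ A itself unless t is one of the ≤ 2 colours of C ∖ A.
data Slack (C A : List ℕ) : Set where
  twoOutside : ∀ {p q} → p ∈ A → q ∈ A → p ∉ C → q ∉ C → p ≢ q → Slack C A
  fewMissing : length (C ∖ A) ≤ 2 → Slack C A

blocked : ∀ {C A} → Slack C A → List ℕ
blocked         (twoOutside _ _ _ _ _) = []
blocked {C} {A} (fewMissing _)         = C ∖ A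

length-blocked : ∀ {C A} (s : Slack C A) → length (blocked s) ≤ 2
length-blocked (twoOutside _ _ _ _ _) = z≤n
length-blocked (fewMissing ≤2)        = ≤2

cancel-bound : ∀ a x c o b → a + x ≤ c + o → c ≤ suc a → o ≤ b → x ≤ suc b
cancel-bound a x c o b a+x≤c+o c≤1+a o≤b = +-cancelˡ-≤ a x (suc b) (begin
  a + x     ≤⟨ a+x≤c+o ⟩
  c + o     ≤⟨ +-mono-≤ c≤1+a o≤b ⟩
  suc a + b ≡⟨ +-suc a b ⟨
  a + suc b ∎)
  where open ≤-Reasoning

slack : ∀ {C A} → Unique A → Unique C → length C ≤ suc (length A) → Slack C A
slack {C} {A} uA uC C≤1+A = fromOutside (A ∖ C) ∈-∖⁺ (∈-∖⁻ A) (∖-unique C uA)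
  where
  fromOutside : (O : List ℕ) → (∀ {a} → a ∈ A → a ∉ C → a ∈ O) →
                (∀ {a} → a ∈ O → a ∈ A × a ∉ C) → Unique O → Slack C A
  fromOutside (p ∷ q ∷ _) _ O⊆A∖C ((p≢q All.∷ _) AllPairs.∷ _) =
    let p∈A , p∉C = O⊆A∖C (here refl); q∈A , q∉C = O⊆A∖C (there (here refl))
    in  twoOutside p∈A q∈A p∉C q∉C p≢q
  fromOutside [] A∖C⊆O _ _ =
    fewMissing (cancel-bound _ _ _ 0 1 (length-∖-bound uA uC A∖C⊆O) C≤1+A z≤n)
  fromOutside (p ∷ []) A∖C⊆O _ _ =
    fewMissing (cancel-bound _ _ _ 1 1 (length-∖-bound uA uC A∖C⊆O) C≤1+A ≤-refl)

⊆⇒length-∖≤1 : ∀ {C A} → Unique A → Unique C → length C ≤ suc (length A) → A ⊆ C →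
               length (C ∖ A) ≤ 1
⊆⇒length-∖≤1 uA uC C≤1+A A⊆C =
  cancel-bound _ _ _ 0 0 (length-∖-bound {O = []} uA uC λ a∈A a∉C → contradiction (A⊆C a∈A) a∉C) C≤1+A z≤n

DistinctChoice : ∀ {d} → (Fin d → List ℕ) → (Fin d → ℕ) → Set
DistinctChoice B c = (∀ i → c i ∈ B i) × Injective _≡_ _≡_ c

Spare : ∀ {d} → (Fin d → ℕ) → List ℕ → Set
Spare c A = ∃ λ a → a ∈ A × ∀ i → c i ≢ a

∉-tabulate : ∀ {d} {c : Fin d → ℕ} {a} → a ∉ tabulate c → ∀ i → c i ≢ a
∉-tabulate a∉c i refl = a∉c (∈-tabulate⁺ i)

-- F collects the colours already used, so the greedy choice is injective.
greedyChoice : ∀ m (B : Fin m → List ℕ) (F : List ℕ) → (∀ i → Unique (B i)) →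
               (∀ i → m + length F < length (B i)) →
               Σ (Fin m → ℕ) λ c → DistinctChoice B c × (∀ i → c i ∉ F)
greedyChoice zero    B F _  _     = (λ ()) , ((λ ()) , λ { {()} }) , λ ()
greedyChoice (suc m) B F uB long
  with x , x∈B₀ , x∉F ← ∃∉-of-length< (uB Fin.zero) (≤-<-trans (m≤n+m (length F) (suc m)) (long Fin.zero))
  with c , (c∈B , c-inj) , c∉x∷F ← greedyChoice m (B ∘ Fin.suc) (x ∷ F) (uB ∘ Fin.suc)
         (λ i → subst (_< length (B (Fin.suc i))) (sym (+-suc m (length F))) (long (Fin.suc i)))
  = x Vector.∷ c , (∈B , λ {i} {j} → injective i j) , ∉F
  where
  ∈B : ∀ i → (x Vector.∷ c) i ∈ B i
  ∈B Fin.zero    = x∈B₀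
  ∈B (Fin.suc i) = c∈B i
  ∉F : ∀ i → (x Vector.∷ c) i ∉ F
  ∉F Fin.zero    = x∉F
  ∉F (Fin.suc i) = c∉x∷F i ∘ there
  injective : ∀ i j → (x Vector.∷ c) i ≡ (x Vector.∷ c) j → i ≡ j
  injective Fin.zero    Fin.zero    _  = refl
  injective Fin.zero    (Fin.suc j) eq = contradiction (here (sym eq)) (c∉x∷F j)
  injective (Fin.suc i) Fin.zero    eq = contradiction (here eq) (c∉x∷F i)
  injective (Fin.suc i) (Fin.suc j) eq = cong Fin.suc (c-inj eq)

module Recolour {d} (c : Fin d → ℕ) (c-inj : Injective _≡_ _≡_ c) (v : Fin d) {y} (y∉c : y ∉ tabulate c) where

  c′ : Fin d → ℕ
  c′ = updateAt c v (const y)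

  view : ∀ i → (i ≡ v × c′ i ≡ y) ⊎ (i ≢ v × c′ i ≡ c i)
  view i with i Fin.≟ v
  ... | yes refl = inj₁ (refl , updateAt-updates v c)
  ... | no  i≢v  = inj₂ (i≢v , updateAt-minimal i v c i≢v)

  c′-∈ : ∀ {B : Fin d → List ℕ} → y ∈ B v → (∀ i → c i ∈ B i) → ∀ i → c′ i ∈ B i
  c′-∈ {B} y∈Bv c∈B i with view i
  ... | inj₁ (refl , c′v≡y) = subst (_∈ B v) (sym c′v≡y) y∈Bv
  ... | inj₂ (_ , c′i≡ci)   = subst (_∈ B i) (sym c′i≡ci) (c∈B i)

  c′-avoids : ∀ {a} → a ∉ tabulate c → a ≢ y → ∀ i → c′ i ≢ a
  c′-avoids a∉c a≢y i c′i≡a with view i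
  ... | inj₁ (_ , c′i≡y)  = a≢y (trans (sym c′i≡a) c′i≡y)
  ... | inj₂ (_ , c′i≡ci) = ∉-tabulate a∉c i (trans (sym c′i≡ci) c′i≡a)

  c′-frees : ∀ i → c′ i ≢ c v
  c′-frees i c′i≡cv with view i
  ... | inj₁ (_ , c′i≡y)    = ∉-tabulate y∉c v (trans (sym c′i≡cv) c′i≡y)
  ... | inj₂ (i≢v , c′i≡ci) = i≢v (c-inj (trans (sym c′i≡ci) c′i≡cv))

  c′-injective : Injective _≡_ _≡_ c′
  c′-injective {i} {j} c′i≡c′j with view i | view j
  ... | inj₁ (i≡v , _)     | inj₁ (j≡v , _)     = trans i≡v (sym j≡v)
  ... | inj₁ (_ , c′i≡y)   | inj₂ (_ , c′j≡cj)  =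
    ⊥-elim (∉-tabulate y∉c j (trans (sym c′j≡cj) (trans (sym c′i≡c′j) c′i≡y)))
  ... | inj₂ (_ , c′i≡ci)  | inj₁ (_ , c′j≡y)   =
    ⊥-elim (∉-tabulate y∉c i (trans (sym c′i≡ci) (trans c′i≡c′j c′j≡y)))
  ... | inj₂ (_ , c′i≡ci)  | inj₂ (_ , c′j≡cj)  = c-inj (trans (sym c′i≡ci) (trans c′i≡c′j c′j≡cj))

  spare-freed : ∀ {A} → c v ∈ A → Spare c′ A
  spare-freed cv∈A = c v , cv∈A , c′-frees

  spare-slack : ∀ {A} (s : Slack (tabulate c) A) → c v ∉ blocked s → Spare c′ A
  spare-slack (twoOutside {p} {q} p∈A q∈A p∉c q∉c p≢q) _ with p ≟ y
  ... | yes p≡y = q , q∈A , c′-avoids q∉c (λ q≡y → p≢q (trans p≡y (sym q≡y)))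
  ... | no  p≢y = p , p∈A , c′-avoids p∉c p≢y
  spare-slack (fewMissing _) cv∉c∖A = spare-freed (∉-∖⇒∈ (∈-tabulate⁺ v) cv∉c∖A)

length-concatMap≤ : ∀ {A B : Set} {f : A → List B} {m} → (∀ x → length (f x) ≤ m) →
                    ∀ xs → length (concatMap f xs) ≤ length xs * m
length-concatMap≤ f≤m []       = z≤n
length-concatMap≤ {f = f} {m} f≤m (x ∷ xs) = begin
  length (f x ++ concatMap f xs)         ≡⟨ length-++ (f x) ⟩
  length (f x) + length (concatMap f xs) ≤⟨ +-mono-≤ (f≤m x) (length-concatMap≤ f≤m xs) ⟩
  m + length xs * m                      ∎
  where open ≤-Reasoning

blockedColours : ∀ {m C} (A₀ : List ℕ) {A : Fin m → List ℕ} → (∀ j → Slack C (A j)) → List ℕ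
blockedColours {m} {C} A₀ s = C ∖ A₀ ++ concatMap (blocked ∘ s) (allFin m)

length-blockedColours : ∀ {m C A₀} {A : Fin m → List ℕ} (s : ∀ j → Slack C (A j)) →
                        length (C ∖ A₀) ≤ 1 → length (blockedColours A₀ s) ≤ 1 + m * 2
length-blockedColours {m} {C} {A₀} s A₀-tight = begin
  length (C ∖ A₀ ++ concatMap (blocked ∘ s) (allFin m))           ≡⟨ length-++ (C ∖ A₀) ⟩
  length (C ∖ A₀) + length (concatMap (blocked ∘ s) (allFin m))   ≤⟨ +-mono-≤ A₀-tight
                                                                      (length-concatMap≤ (length-blocked ∘ s) (allFin m)) ⟩
  1 + length (allFin m) * 2                                       ≡⟨ cong (λ l → 1 + l * 2) (length-tabulate {n = m} id) ⟩
  1 + m * 2                                                       ∎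
  where open ≤-Reasoning

-- At most 1 + 2m colours of C are blocked, so some colour c v is not; v gets a fresh colour
-- and c v is freed for every list that contains it.
recolourForSpares : ∀ {d m} (B : Fin d → List ℕ) → (∀ i → Unique (B i)) → (∀ i → d < length (B i)) →
  (c : Fin d → ℕ) → DistinctChoice B c →
  (A₀ : List ℕ) → length (tabulate c ∖ A₀) ≤ 1 →
  (A : Fin m → List ℕ) → (s : ∀ j → Slack (tabulate c) (A j)) → 1 + m * 2 < d →
  Σ (Fin d → ℕ) λ c′ → DistinctChoice B c′ × Spare c′ A₀ × (∀ j → Spare c′ (A j))
recolourForSpares {d} {m} B uB long c (c∈B , c-inj) A₀ A₀-tight A s 1+2m<d
  with t , t∈C , t∉E ← ∃∉-of-length< {Y = blockedColours A₀ s} (Unique.tabulate⁺ c-inj)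
         (subst (length (blockedColours A₀ s) <_) (sym (length-tabulate c))
                (≤-<-trans (length-blockedColours s A₀-tight) 1+2m<d))
  with v , refl ← ∈-tabulate⁻ t∈C
  with y , y∈Bv , y∉C ← ∃∉-of-length< {Y = tabulate c} (uB v)
         (subst (_< length (B v)) (sym (length-tabulate c)) (long v))
  = c′ , (c′-∈ y∈Bv c∈B , c′-injective) , spare-freed (∉-∖⇒∈ t∈C (t∉E ∘ ∈-++⁺ˡ)) , spare
  where
  open Recolour c c-inj v y∉C
  spare : ∀ j → Spare c′ (A j)
  spare j = spare-slack (s j) λ cv∈s →
    t∉E (∈-++⁺ʳ (tabulate c ∖ A₀) (∈-concatMap⁺ (blocked ∘ s) (lose (∈-allFin j) cv∈s)))

punchIn-elim : ∀ {k} {P : Fin (suc k) → Set} (i : Fin (suc k)) → P i → (∀ j → P (punchIn i j)) → ∀ j → P j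
punchIn-elim {P = P} i Pi P-punchIn j with i Fin.≟ j
... | yes refl = Pi
... | no  i≢j  = subst P (punchIn-punchOut i≢j) (P-punchIn (punchOut i≢j))

spare-outside : ∀ {d} {c : Fin d → ℕ} {A} → ¬ A ⊆ tabulate c → Spare c A
spare-outside {c = c} {A} A⊈c =
  let a , a∈A , a∉c = find (¬All⇒Any¬ (_∈? tabulate c) A (A⊈c ∘ All.lookup))
  in  a , a∈A , ∉-tabulate a∉c

distinctChoice : ∀ {d} (B : Fin d → List ℕ) → (∀ i → Unique (B i)) → (∀ i → d < length (B i)) →
                 Σ (Fin d → ℕ) (DistinctChoice B)
distinctChoice {d} B uB long =
  let c , c-choice , _ = greedyChoice d B [] uB (λ i → subst (_< length (B i)) (sym (+-identityʳ d)) (long i))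
  in  c , c-choice

choiceWithSpares : ∀ d k → k * 2 ≤ d →
  (B : Fin d → List ℕ) → (∀ i → Unique (B i)) → (∀ i → d < length (B i)) →
  (A : Fin k → List ℕ) → (∀ j → Unique (A j)) → (∀ j → d ≤ suc (length (A j))) →
  Σ (Fin d → ℕ) λ c → DistinctChoice B c × (∀ j → Spare c (A j))
choiceWithSpares d zero _ B uB long _ _ _ = let c , c-choice = distinctChoice B uB long in c , c-choice , λ ()
choiceWithSpares d (suc m) 2k≤d B uB long A uA A-long
  with c , c-choice@(_ , c-inj) ← distinctChoice B uB long
  with any? (λ j → All.all? (_∈? tabulate c) (A j))
... | no  ¬A⊆c        = c , c-choice , λ j → spare-outside (λ A⊆c → ¬A⊆c (j , All.tabulate A⊆c))
... | yes (j₀ , A₀⊆c) =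
  let c′ , c′-choice , spare₀ , spare = recolourForSpares B uB long c c-choice
        (A j₀) (⊆⇒length-∖≤1 (uA j₀) uC (C≤1+A j₀) (All.lookup A₀⊆c))
        (A ∘ punchIn j₀) (λ j → slack (uA (punchIn j₀ j)) uC (C≤1+A (punchIn j₀ j))) 2k≤d
  in  c′ , c′-choice , punchIn-elim j₀ spare₀ spare
  where
  uC : Unique (tabulate c)
  uC = Unique.tabulate⁺ c-inj
  C≤1+A : ∀ j → length (tabulate c) ≤ suc (length (A j))
  C≤1+A j = subst (_≤ suc (length (A j))) (sym (length-tabulate c)) (A-long j)

module _ {n} (Q : Graph n) where

  Adj-sym : ∀ {v w} → Adj Q v w → Adj Q w v
  Adj-sym {v} {w} vw = trans (Graph.sym Q w v) vw

  Adj-irrefl : ∀ {v} → ¬ Adj Q v v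
  Adj-irrefl {v} vv with trans (sym vv) (irrefl Q v)
  ... | ()

  length≤deg : ∀ v {W} → Unique W → (∀ {w} → w ∈ W → Adj Q v w) → length W ≤ deg Q v
  length≤deg v {W} uW W⊆N = begin
    length W                              ≤⟨ ⊆⇒length≤ uW W⊆filter ⟩
    length (filterᵇ (adj Q v) (allFin n)) ≡⟨ count (allFin n) ⟨
    deg Q v                               ∎
    where
    open ≤-Reasoning
    W⊆filter : W ⊆ filterᵇ (adj Q v) (allFin n)
    W⊆filter w∈W = ∈-filter⁺ (T? ∘ adj Q v) (∈-allFin _) (subst T (sym (W⊆N w∈W)) _)
    count : ∀ ws → sum (map (λ w → if adj Q v w then 1 else 0) ws) ≡ length (filterᵇ (adj Q v) ws)
    count []       = refl
    count (w ∷ ws) with adj Q v w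
    ... | true  = cong suc (count ws)
    ... | false = count ws

  image-length≤deg : ∀ {m} v (f : Fin m → Fin n) → (∀ i j → f i ≡ f j → i ≡ j) → (∀ i → Adj Q v (f i)) →
                     m ≤ deg Q v
  image-length≤deg {m} v f f-inj v-f = begin
    m                    ≡⟨ length-tabulate f ⟨
    length (tabulate f)  ≤⟨ length≤deg v (Unique.tabulate⁺ (f-inj _ _)) f⊆N ⟩
    deg Q v              ∎
    where
    open ≤-Reasoning
    f⊆N : ∀ {w} → w ∈ tabulate f → Adj Q v w
    f⊆N w∈f with i , refl ← ∈-tabulate⁻ {f = f} w∈f = v-f i

  clique-length≤deg : ∀ {d} (K : Fin (suc d) → Fin n) → (∀ i j → K i ≡ K j → i ≡ j) →
    (∀ i j → i ≢ j → Adj Q (K i) (K j)) → ∀ i {X} → Unique X →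
    (∀ {x} → x ∈ X → (∀ j → K j ≢ x) × Adj Q (K i) x) → length X + d ≤ deg Q (K i)
  clique-length≤deg {d} K K-inj K-clique i {X} uX X-outside = begin
    length X + d                                 ≡⟨ cong (length X +_) (length-tabulate (K ∘ punchIn i)) ⟨
    length X + length (tabulate (K ∘ punchIn i)) ≡⟨ length-++ X ⟨
    length (X ++ tabulate (K ∘ punchIn i))       ≤⟨ length≤deg (K i) uW W⊆N ⟩
    deg Q (K i)                                  ∎
    where
    open ≤-Reasoning
    uW : Unique (X ++ tabulate (K ∘ punchIn i))
    uW = Unique.++⁺ uX (Unique.tabulate⁺ (punchIn-injective i _ _ ∘ K-inj _ _)) λ (x∈X , x∈K) →
      let j , x≡K = ∈-tabulate⁻ {f = K ∘ punchIn i} x∈K in proj₁ (X-outside x∈X) _ (sym x≡K)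
    W⊆N : ∀ {w} → w ∈ X ++ tabulate (K ∘ punchIn i) → Adj Q (K i) w
    W⊆N w∈W with ∈-++⁻ X w∈W
    ... | inj₁ w∈X = proj₂ (X-outside w∈X)
    ... | inj₂ w∈K with j , refl ← ∈-tabulate⁻ {f = K ∘ punchIn i} w∈K =
      K-clique i (punchIn i j) (punchInᵢ≢i i j ∘ sym)

  joinColouring : ∀ {d k} (L : Fin n → List ℕ) (K : Fin d → Fin n) (u : Fin k → Fin n) →
    (∀ v → (∃ λ i → K i ≡ v) ⊎ (∃ λ j → u j ≡ v)) → (∀ j l → ¬ Adj Q (u j) (u l)) →
    (c : Fin d → ℕ) → DistinctChoice (L ∘ K) c → (∀ j → Spare c (L (u j))) →
    Σ (Fin n → ℕ) (ProperListColouring Q L)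
  joinColouring L K u part independent c (c∈L , c-inj) spare = φ , φ∈L , proper
    where
    φ : Fin n → ℕ
    φ v = [ c ∘ proj₁ , proj₁ ∘ spare ∘ proj₁ ] (part v)
    φ∈L : ∀ v → φ v ∈ L v
    φ∈L v with part v
    ... | inj₁ (i , refl) = c∈L i
    ... | inj₂ (j , refl) = proj₁ (proj₂ (spare j))
    proper : ∀ v w → Adj Q v w → φ v ≢ φ w
    proper v w vw with part v | part w
    ... | inj₁ (i , refl) | inj₁ (j , refl) = λ ci≡cj → Adj-irrefl (subst (Adj Q (K i) ∘ K) (sym (c-inj ci≡cj)) vw)
    ... | inj₁ (i , refl) | inj₂ (j , refl) = proj₂ (proj₂ (spare j)) i
    ... | inj₂ (j , refl) | inj₁ (i , refl) = proj₂ (proj₂ (spare j)) i ∘ sym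
    ... | inj₂ (j , refl) | inj₂ (l , refl) = contradiction vw (independent j l)

lemmaB2 : (d : ℕ) → 6 ≤ d → (n : ℕ) → (Q : Graph n) →
    (K : Fin d → Fin n) → (u₁ u₂ u₃ : Fin n) →
    (∀ i j → K i ≡ K j → i ≡ j) →
    u₁ ≢ u₂ → u₁ ≢ u₃ → u₂ ≢ u₃ →
    (∀ i → K i ≢ u₁) → (∀ i → K i ≢ u₂) → (∀ i → K i ≢ u₃) →
    (∀ v → (Σ (Fin d) (λ i → K i ≡ v)) ⊎ (v ≡ u₁ ⊎ (v ≡ u₂ ⊎ v ≡ u₃))) →
    (∀ i j → i ≢ j → Adj Q (K i) (K j)) →
    ¬ Adj Q u₁ u₂ → ¬ Adj Q u₁ u₃ → ¬ Adj Q u₂ u₃ →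
    (∀ i → Adj Q u₁ (K i)) → (∀ i → Adj Q u₂ (K i)) → (∀ i → Adj Q u₃ (K i)) →
    DegMinusOneChoosable Q
lemmaB2 zero ()
lemmaB2 d@(suc d′) 6≤d n Q K u₁ u₂ u₃ K-inj u₁≢u₂ u₁≢u₃ u₂≢u₃ K≢u₁ K≢u₂ K≢u₃ cover K-clique
        ¬u₁u₂ ¬u₁u₃ ¬u₂u₃ u₁K u₂K u₃K L uL L-length =
  let c , c-choice , spare = choiceWithSpares d 3 6≤d (L ∘ K) (uL ∘ K) K-long (L ∘ u) (uL ∘ u) u-long
  in  joinColouring Q L K u part independent c c-choice spare
  where
  u : Fin 3 → Fin n
  u 0F = u₁
  u 1F = u₂
  u 2F = u₃
  part : ∀ v → (∃ λ i → K i ≡ v) ⊎ (∃ λ j → u j ≡ v)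
  part v with cover v
  ... | inj₁ Kv                  = inj₁ Kv
  ... | inj₂ (inj₁ refl)         = inj₂ (0F , refl)
  ... | inj₂ (inj₂ (inj₁ refl))  = inj₂ (1F , refl)
  ... | inj₂ (inj₂ (inj₂ refl))  = inj₂ (2F , refl)
  independent : ∀ j l → ¬ Adj Q (u j) (u l)
  independent 0F 1F = ¬u₁u₂
  independent 0F 2F = ¬u₁u₃
  independent 1F 2F = ¬u₂u₃
  independent 1F 0F = ¬u₁u₂ ∘ Adj-sym Q
  independent 2F 0F = ¬u₁u₃ ∘ Adj-sym Q
  independent 2F 1F = ¬u₂u₃ ∘ Adj-sym Q
  independent 0F 0F = Adj-irrefl Q
  independent 1F 1F = Adj-irrefl Q
  independent 2F 2F = Adj-irrefl Q
  uK : ∀ j i → Adj Q (u j) (K i)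
  uK 0F = u₁K
  uK 1F = u₂K
  uK 2F = u₃K
  listLength : ∀ {m} v → m ≤ deg Q v → m ∸ 1 ≤ length (L v)
  listLength v m≤deg = subst (_ ≤_) (sym (L-length v)) (∸-monoˡ-≤ 1 m≤deg)
  u-long : ∀ j → d ≤ suc (length (L (u j)))
  u-long j = ≤-trans (m≤n+m∸n d 1) (s≤s (listLength (u j) (image-length≤deg Q (u j) K K-inj (uK j))))
  K-long : ∀ i → d < length (L (K i))
  K-long i = listLength (K i) (clique-length≤deg Q K K-inj K-clique i uU U-outside)
    where
    uU : Unique (u₁ ∷ u₂ ∷ u₃ ∷ [])
    uU = (u₁≢u₂ All.∷ u₁≢u₃ All.∷ All.[]) AllPairs.∷ (u₂≢u₃ All.∷ All.[])
         AllPairs.∷ All.[] AllPairs.∷ AllPairs.[]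
    U-outside : ∀ {x} → x ∈ u₁ ∷ u₂ ∷ u₃ ∷ [] → (∀ j → K j ≢ x) × Adj Q (K i) x
    U-outside (here refl)                 = K≢u₁ , Adj-sym Q (u₁K i)
    U-outside (there (here refl))         = K≢u₂ , Adj-sym Q (u₂K i)
    U-outside (there (there (here refl))) = K≢u₃ , Adj-sym Q (u₃K i)
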